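{- Let $\mathfrak{A}=(A;=,+,V_2)$ be a non-standard model of $\mathrm{BA}_2$ and let $x\in A$ be non-standard. Then $x$ is a hypernumber (i.e., $V_2(x)$ is non-standard) if and only if $x$ is divisible in $\mathfrak{A}$ by every standard power of $2$, i.e., for every $k\in\mathbb{N}$ there is $z\in A$ with $\underbrace{z+\cdots+z}_{2^k\text{ times}}=x$.
   Context: $\mathrm{BA}_2=\mathrm{Th}(\mathbb{N};=,+,V_2)$, where $V_2(x)$ is the largest power of $2$ dividing $x$ for $x\neq 0$ and $V_2(0)=0$. In a model, the standard natural numbers are the elements $0,1,1+1,\ldots$; all other elements are non-standard. A non-standard element $x$ is called a hypernumber if $V_2(x)$ is non-standard. -}

module Defs where

open import Data.Nat using (ℕ; zero; suc; _+_; _*_; _^_; _∸_; pred; _%_; _/_)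
open import Data.Fin using (Fin; zero; suc)
open import Data.Vec using (Vec; []; _∷_; lookup)
open import Data.Product using (Σ; _×_; _,_; ∃)
open import Data.Sum using (_⊎_)
open import Data.Empty using (⊥)
open import Relation.Binary.PropositionalEquality using (_≡_)

data Term (n : ℕ) : Set where
  var  : Fin n → Term n
  _⊕_  : Term n → Term n → Term n
  V₂   : Term n → Term n

infixl 6 _⊕_

data Formula : ℕ → Set where
  _≈_  : ∀ {n} → Term n → Term n → Formula n
  ⊥f   : ∀ {n} → Formula n
  _⇒_  : ∀ {n} → Formula n → Formula n → Formula n
  _∧f_ : ∀ {n} → Formula n → Formula n → Formula n
  _∨f_ : ∀ {n} → Formula n → Formula n → Formula n
  ∀f   : ∀ {n} → Formula (suc n) → Formula n
  ∃f   : ∀ {n} → Formula (suc n) → Formula n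

infix 4 _≈_
infixr 3 _∧f_

¬f : ∀ {n} → Formula n → Formula n
¬f φ = φ ⇒ ⊥f

Sentence : Set
Sentence = Formula 0

record Structure : Set₁ where
  field
    Carrier : Set
    add     : Carrier → Carrier → Carrier
    v2      : Carrier → Carrier

module _ (A : Structure) where
  open Structure A

  evalT : ∀ {n} → Vec Carrier n → Term n → Carrier
  evalT ρ (var i) = lookup ρ i
  evalT ρ (s ⊕ t) = add (evalT ρ s) (evalT ρ t)
  evalT ρ (V₂ t)  = v2 (evalT ρ t)

  Sat : ∀ {n} → Vec Carrier n → Formula n → Set
  Sat ρ (s ≈ t)  = evalT ρ s ≡ evalT ρ t
  Sat ρ ⊥f       = ⊥
  Sat ρ (φ ⇒ ψ)  = Sat ρ φ → Sat ρ ψ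
  Sat ρ (φ ∧f ψ) = Sat ρ φ × Sat ρ ψ
  Sat ρ (φ ∨f ψ) = Sat ρ φ ⊎ Sat ρ ψ
  Sat ρ (∀f φ)   = (a : Carrier) → Sat (a ∷ ρ) φ
  Sat ρ (∃f φ)   = Σ Carrier λ a → Sat (a ∷ ρ) φ

-- V₂(x) = largest power of 2 dividing x (x ≠ 0), V₂(0) = 0.
-- v2ℕ' f x uses fuel f; with f = x the fuel is always sufficient.
v2ℕ' : ℕ → ℕ → ℕ
v2ℕ' _ zero = 0
v2ℕ' zero (suc x) = 1
v2ℕ' (suc f) (suc x) with (suc x) % 2
... | zero = 2 * v2ℕ' f (suc x / 2)
... | suc _ = 1

v2ℕ : ℕ → ℕ
v2ℕ x = v2ℕ' x x

ℕ-str : Structure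
ℕ-str = record { Carrier = ℕ ; add = _+_ ; v2 = v2ℕ }

-- 𝔄 is a model of BA₂ = Th(ℕ; =, +, V₂): it satisfies every sentence true in ℕ.
IsModelBA₂ : Structure → Set
IsModelBA₂ A = (φ : Sentence) → Sat ℕ-str [] φ → Sat A [] φ

v0 : ∀ {n} → Term (suc n)
v0 = var zero

v1 : ∀ {n} → Term (suc (suc n))
v1 = var (suc zero)

isOne : ∀ {n} → Formula (suc n)
isOne = ¬f (v0 ⊕ v0 ≈ v0) ∧f (V₂ v0 ≈ v0) ∧f ¬f (∃f (v0 ⊕ v0 ≈ v1))

copiesT : ∀ {n} → ℕ → Term n → Term n
copiesT zero t = t
copiesT (suc m) t = t ⊕ copiesT m t

-- numeral k : the formula (in free variable var 0) "x = 1 + ... + 1 (k times)",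
-- with "x = 0" expressed as x + x = x
numeral : ℕ → Formula 1
numeral zero = v0 ⊕ v0 ≈ v0
numeral (suc m) = ∃f (isOne ∧f (v1 ≈ copiesT m v0))

module _ (A : Structure) where
  open Structure A

  Standard : Carrier → Set
  Standard a = ∃ λ k → Sat A (a ∷ []) (numeral k)

  NonStandard : Carrier → Set
  NonStandard a = Standard a → ⊥

  NonStandardModel : Set
  NonStandardModel = ∃ λ a → NonStandard a

  Hypernumber : Carrier → Set
  Hypernumber x = NonStandard x × NonStandard (v2 x)

  copies : ℕ → Carrier → Carrier
  copies zero z = z
  copies (suc m) z = add z (copies m z)

  DivBy2^ : ℕ → Carrier → Set
  DivBy2^ k x = ∃ λ z → copies (pred (2 ^ k)) z ≡ x

-- In ℕ, V₂(x) = 2^j where 2^j is the exact power of 2 dividing x ≠ 0.  Two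
-- families of sentences, indexed by standard k, are therefore true in ℕ and
-- hence in 𝔄:
--   if V₂(x) differs from 2^0, …, 2^(k-1) then 2^k divides x;
--   if V₂(x) = m then 2^m does not divide x (because 2^j < 2^(j+1) ≤ 2^(2^j)).
-- A non-standard V₂(x) differs from every standard 2^i, so the first family gives
-- divisibility by every 2^k; a standard V₂(x) = m is excluded by the second.
module Submission where

open import Defs
open import Data.Nat using (ℕ; zero; suc; _+_; _*_; _^_; _∸_; pred; _%_; _/_; _≤_; _<_; z≤n; s≤s; _≤?_)
open import Data.Nat.Properties
open import Data.Nat.DivMod using (m≡m%n+[m/n]*n; m%n<n; m/n<m; [m+kn]%n≡m%n)
open import Data.Nat.Divisibility
  using (_∣_; _∤_; divides; ∣-trans; *-cancelˡ-∣; n∣m⇒m%n≡0; ∣1⇒≡1)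
open import Data.Vec using (Vec; []; _∷_)
open import Data.Product using (_×_; _,_; ∃)
open import Data.Empty using (⊥-elim)
open import Data.Sum using (inj₁; inj₂)
open import Function.Bundles using (_⇔_; mk⇔; Equivalence)
open import Relation.Nullary using (¬_; yes; no)
open import Relation.Binary.PropositionalEquality

open Equivalence

^-monoʳ-∣ : ∀ m {k j} → k ≤ j → m ^ k ∣ m ^ j
^-monoʳ-∣ m {k} {j} k≤j = divides (m ^ (j ∸ k)) (begin
  m ^ j                 ≡⟨ cong (m ^_) (m+[n∸m]≡n k≤j) ⟨
  m ^ (k + (j ∸ k))     ≡⟨ ^-distribˡ-+-* m k (j ∸ k) ⟩
  m ^ k * m ^ (j ∸ k)   ≡⟨ *-comm (m ^ k) (m ^ (j ∸ k)) ⟩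
  m ^ (j ∸ k) * m ^ k   ∎)
  where open ≡-Reasoning

n<2^n : ∀ n → n < 2 ^ n
n<2^n zero    = s≤s z≤n
n<2^n (suc n) = subst (suc (suc n) ≤_) (cong (2 ^ n +_) (sym (+-identityʳ (2 ^ n))))
                  (+-mono-≤ (m^n>0 2 n) (n<2^n n))

1+2o%2≡1 : ∀ o → (1 + o * 2) % 2 ≡ 1
1+2o%2≡1 o = [m+kn]%n≡m%n 1 o 2

record HasTwoAdicValuation (n j : ℕ) : Set where
  constructor _,_
  field
    oddPart       : ℕ
    decomposition : n ≡ 2 ^ j * (1 + oddPart * 2)

valuation⇒2^j∣ : ∀ {n j} → HasTwoAdicValuation n j → 2 ^ j ∣ n
valuation⇒2^j∣ {j = j} (o , n≡) = divides (1 + o * 2) (trans n≡ (*-comm (2 ^ j) _))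

valuation⇒2^[1+j]∤ : ∀ {n j} → HasTwoAdicValuation n j → 2 ^ suc j ∤ n
valuation⇒2^[1+j]∤ {j = j} (o , refl) 2^[1+j]∣n = 1+n≢0 (trans (sym (1+2o%2≡1 o))
  (n∣m⇒m%n≡0 (1 + o * 2) 2 (*-cancelˡ-∣ (2 ^ j) {{m^n≢0 2 j}}
    (subst (_∣ 2 ^ j * (1 + o * 2)) (*-comm 2 (2 ^ j)) 2^[1+j]∣n))))

v2ℕ'-valuation : ∀ f n → n ≢ 0 → n ≤ f → ∃ λ j → v2ℕ' f n ≡ 2 ^ j × HasTwoAdicValuation n j
v2ℕ'-valuation f zero n≢0 _ = ⊥-elim (n≢0 refl)
v2ℕ'-valuation (suc f) (suc x) _ (s≤s x≤f)
  with suc x % 2 | m≡m%n+[m/n]*n (suc x) 2 | m%n<n (suc x) 2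
... | suc (suc _) | _       | s≤s (s≤s ())
... | suc zero    | n≡1+h*2 | _ = 0 , refl , suc x / 2 , trans n≡1+h*2 (sym (*-identityˡ _))
... | zero        | n≡h*2   | _
  with v2ℕ'-valuation f (suc x / 2) (λ h≡0 → 1+n≢0 (trans n≡h*2 (cong (_* 2) h≡0)))
                      (≤-trans (≤-pred (m/n<m (suc x) 2 (s≤s (s≤s z≤n)))) x≤f)
...   | j , v≡2^j , o , h≡ = suc j , cong (2 *_) v≡2^j , o , (begin
  suc x                     ≡⟨ n≡h*2 ⟩
  suc x / 2 * 2             ≡⟨ cong (_* 2) h≡ ⟩
  2 ^ j * (1 + o * 2) * 2   ≡⟨ *-comm (2 ^ j * (1 + o * 2)) 2 ⟩
  2 * (2 ^ j * (1 + o * 2)) ≡⟨ *-assoc 2 (2 ^ j) (1 + o * 2) ⟨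
  2 ^ suc j * (1 + o * 2)   ∎)
  where open ≡-Reasoning

v2ℕ-valuation : ∀ n → n ≢ 0 → ∃ λ j → v2ℕ n ≡ 2 ^ j × HasTwoAdicValuation n j
v2ℕ-valuation n n≢0 = v2ℕ'-valuation n n n≢0 ≤-refl

evalT-copiesT : ∀ A {n} (ρ : Vec (Structure.Carrier A) n) m t →
  evalT A ρ (copiesT m t) ≡ copies A m (evalT A ρ t)
evalT-copiesT A ρ zero    t = refl
evalT-copiesT A ρ (suc m) t = cong (Structure.add A (evalT A ρ t)) (evalT-copiesT A ρ m t)

copiesℕ : ∀ m z → copies ℕ-str m z ≡ suc m * z
copiesℕ zero    z = sym (+-identityʳ z)
copiesℕ (suc m) z = cong (z +_) (copiesℕ m z)

DivBy2^ℕ⇔∣ : ∀ k x → DivBy2^ ℕ-str k x ⇔ 2 ^ k ∣ x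
DivBy2^ℕ⇔∣ k x = mk⇔
  (λ (z , zs≡x) → divides z (trans (sym zs≡x) (trans (copies≡ z) (*-comm (2 ^ k) z))))
  (λ (divides q x≡) → q , trans (copies≡ q) (trans (*-comm (2 ^ k) q) (sym x≡)))
  where
  copies≡ : ∀ z → copies ℕ-str (pred (2 ^ k)) z ≡ 2 ^ k * z
  copies≡ z = trans (copiesℕ (pred (2 ^ k)) z) (cong (_* z) (suc-pred (2 ^ k) {{m^n≢0 2 k}}))

divisibleBy2^ : ∀ {n} → ℕ → Formula (suc n)
divisibleBy2^ k = ∃f (copiesT (pred (2 ^ k)) v0 ≈ v1)

Sat-divisibleBy2^ : ∀ A {n} (ρ : Vec (Structure.Carrier A) n) k x →
  Sat A (x ∷ ρ) (divisibleBy2^ k) ⇔ DivBy2^ A k x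
Sat-divisibleBy2^ A ρ k x = mk⇔
  (λ (z , e) → z , trans (sym (evalT-copiesT A (z ∷ x ∷ ρ) (pred (2 ^ k)) v0)) e)
  (λ (z , e) → z , trans (evalT-copiesT A (z ∷ x ∷ ρ) (pred (2 ^ k)) v0) e)

2∤1 : ∀ z → z + z ≢ 1
2∤1 z z+z≡1 with ∣1⇒≡1 (divides z (trans (sym z+z≡1) (trans (cong (z +_) (sym (+-identityʳ z))) (*-comm 2 z))))
... | ()

isOne-1 : ∀ {n} (ρ : Vec ℕ n) → Sat ℕ-str (1 ∷ ρ) isOne
isOne-1 ρ = (λ ()) , refl , λ (z , z+z≡1) → 2∤1 z z+z≡1

isOne⇒≡1 : ∀ {n} a (ρ : Vec ℕ n) → Sat ℕ-str (a ∷ ρ) isOne → a ≡ 1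
isOne⇒≡1 a ρ (a+a≢a , v2a≡a , a-odd) with v2ℕ-valuation a (λ { refl → a+a≢a refl })
... | zero  , v2a≡1 , _      = trans (sym v2a≡a) v2a≡1
... | suc i , _     , o , a≡ = ⊥-elim (a-odd (h , (begin
  h + h       ≡⟨ cong (h +_) (+-identityʳ h) ⟨
  2 * h       ≡⟨ *-assoc 2 (2 ^ i) (1 + o * 2) ⟨
  2 ^ suc i * (1 + o * 2) ≡⟨ a≡ ⟨
  a           ∎)))
  where
  h = 2 ^ i * (1 + o * 2)
  open ≡-Reasoning

numeral-refl : ∀ m → Sat ℕ-str (m ∷ []) (numeral m)
numeral-refl zero    = refl
numeral-refl (suc m) = 1 , isOne-1 (suc m ∷ []) ,
  sym (trans (evalT-copiesT ℕ-str (1 ∷ suc m ∷ []) m v0) (trans (copiesℕ m 1) (*-identityʳ (suc m))))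

numeral⇒≡ : ∀ m y → Sat ℕ-str (y ∷ []) (numeral m) → y ≡ m
numeral⇒≡ zero    y y+y≡y = +-cancelʳ-≡ y y 0 y+y≡y
numeral⇒≡ (suc m) y (a , a-one , y≡)
  with refl ← isOne⇒≡1 a (y ∷ []) a-one =
  trans y≡ (trans (evalT-copiesT ℕ-str (1 ∷ y ∷ []) m v0) (trans (copiesℕ m 1) (*-identityʳ (suc m))))

avoidsPowersOf2Below : ℕ → Formula 1
avoidsPowersOf2Below zero    = ⊥f ⇒ ⊥f
avoidsPowersOf2Below (suc k) = ¬f (numeral (2 ^ k)) ∧f avoidsPowersOf2Below k

Sat-avoidsPowersOf2Below : ∀ A y k →
  Sat A (y ∷ []) (avoidsPowersOf2Below k) ⇔ (∀ i → i < k → ¬ Sat A (y ∷ []) (numeral (2 ^ i)))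
Sat-avoidsPowersOf2Below A y k = mk⇔ (elim k) (intro k)
  where
  elim : ∀ k → Sat A (y ∷ []) (avoidsPowersOf2Below k) →
    ∀ i → i < k → ¬ Sat A (y ∷ []) (numeral (2 ^ i))
  elim (suc k) (y≢2^k , rest) i i<1+k with m<1+n⇒m<n∨m≡n i<1+k
  ... | inj₁ i<k  = elim k rest i i<k
  ... | inj₂ refl = y≢2^k
  intro : ∀ k → (∀ i → i < k → ¬ Sat A (y ∷ []) (numeral (2 ^ i))) →
    Sat A (y ∷ []) (avoidsPowersOf2Below k)
  intro zero    _ = λ ()
  intro (suc k) h = h k ≤-refl , intro k (λ i i<k → h i (m≤n⇒m≤1+n i<k))

divisibilitySentence : ℕ → Sentence
divisibilitySentence k = ∀f (avoidsPowersOf2Below k ⇒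
  ∀f ((V₂ v0 ≈ v1) ⇒ (¬f (v0 ⊕ v0 ≈ v0) ⇒ divisibleBy2^ k)))

nonDivisibilitySentence : ℕ → Sentence
nonDivisibilitySentence m = ∀f (numeral m ⇒
  ∀f ((V₂ v0 ≈ v1) ⇒ (¬f (v0 ⊕ v0 ≈ v0) ⇒ ¬f (divisibleBy2^ m))))

divisibilitySentence-ℕ : ∀ k → Sat ℕ-str [] (divisibilitySentence k)
divisibilitySentence-ℕ k y y-avoids x v2x≡y x+x≢x
  with v2ℕ-valuation x (λ { refl → x+x≢x refl })
... | j , v2x≡2^j , val with k ≤? j
...   | yes k≤j = from (Sat-divisibleBy2^ ℕ-str (y ∷ []) k x)
                    (from (DivBy2^ℕ⇔∣ k x) (∣-trans (^-monoʳ-∣ 2 k≤j) (valuation⇒2^j∣ val)))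
...   | no  k≰j = ⊥-elim (to (Sat-avoidsPowersOf2Below ℕ-str y k) y-avoids j (≰⇒> k≰j)
                    (subst (λ t → Sat ℕ-str (t ∷ []) (numeral (2 ^ j)))
                           (trans (sym v2x≡2^j) v2x≡y) (numeral-refl (2 ^ j))))

nonDivisibilitySentence-ℕ : ∀ m → Sat ℕ-str [] (nonDivisibilitySentence m)
nonDivisibilitySentence-ℕ m y y≡m x v2x≡y x+x≢x x-div
  with v2ℕ-valuation x (λ { refl → x+x≢x refl })
... | j , v2x≡2^j , val = valuation⇒2^[1+j]∤ val (∣-trans (^-monoʳ-∣ 2 1+j≤m) 2^m∣x)
  where
  m≡2^j : m ≡ 2 ^ j
  m≡2^j = trans (sym (numeral⇒≡ m y y≡m)) (trans (sym v2x≡y) v2x≡2^j)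
  1+j≤m : suc j ≤ m
  1+j≤m = subst (suc j ≤_) (sym m≡2^j) (n<2^n j)
  2^m∣x : 2 ^ m ∣ x
  2^m∣x = to (DivBy2^ℕ⇔∣ m x) (to (Sat-divisibleBy2^ ℕ-str (y ∷ []) m x) x-div)

-- The hypothesis that 𝔄 is non-standard is implied by x being non-standard.
mainTheorem3 : (A : Structure) → IsModelBA₂ A → NonStandardModel A →
    (x : Structure.Carrier A) → NonStandard A x →
    ((Hypernumber A x → ((k : ℕ) → DivBy2^ A k x)) ×
     (((k : ℕ) → DivBy2^ A k x) → Hypernumber A x))
mainTheorem3 A 𝔄⊨BA₂ _ x x-nonstd = hyper⇒divisible , divisible⇒hyper
  where
  open Structure A
  x+x≢x : add x x ≢ x
  x+x≢x x+x≡x = x-nonstd (0 , x+x≡x)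
  hyper⇒divisible : Hypernumber A x → (k : ℕ) → DivBy2^ A k x
  hyper⇒divisible (_ , v2x-nonstd) k = to (Sat-divisibleBy2^ A (v2 x ∷ []) k x)
    (𝔄⊨BA₂ (divisibilitySentence k) (divisibilitySentence-ℕ k) (v2 x)
      (from (Sat-avoidsPowersOf2Below A (v2 x) k) (λ i _ v2x≡2^i → v2x-nonstd (2 ^ i , v2x≡2^i)))
      x refl x+x≢x)
  divisible⇒hyper : ((k : ℕ) → DivBy2^ A k x) → Hypernumber A x
  divisible⇒hyper x-div = x-nonstd , λ (m , v2x≡m) →
    𝔄⊨BA₂ (nonDivisibilitySentence m) (nonDivisibilitySentence-ℕ m) (v2 x) v2x≡m x refl x+x≢x
      (from (Sat-divisibleBy2^ A (v2 x ∷ []) m x) (x-div m))
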